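{- Suppose $n\geq 8$ and $n\equiv 0\pmod 4$, say $n=4k$ (so that $\gamma_t(C_n)=2k$). Then (i) $D_{2k+1}^t(C_n)$ is disconnected; (ii) if $n\geq 12$, then $C_n$ has a $P_2$-MTDS $S^*$ such that $|S^*|=2k+2$ and $C_n[S^*]$ has four $P_2\overline{P}_1$ components; (iii) all minimum total dominating sets of $C_n$ belong to the same component of $D_{2k+2}^t(C_n)$, and all $P_2$-MTDSs of $C_n$ of cardinality $2k$ or $2k+2$ belong to the same component of $D_{2k+3}^t(C_n)$.
   Context: $C_n=(v_0,\dots,v_{n-1},v_0)$ is the cycle on $n$ vertices. A total dominating set (TDS) is a vertex set $S$ such that every vertex is adjacent to a vertex of $S$; an MTDS is a TDS no proper subset of which is a TDS; $\gamma_t(G)$ is the minimum cardinality of a TDS. A $P_2$-MTDS is an MTDS $S$ of $C_n$ such that every component of the induced subgraph $C_n[S]$ is a $P_2$; a $P_2$ component of such $S$ is a $P_2\overline{P}_1$ component if it is followed (in the direction of increasing index around the cycle) by exactly one vertex not in $S$ before the next component. For a positive integer $k$, $D_k^t(G)$ is the graph whose vertices are the TDSs of $G$ of cardinality at most $k$, two being adjacent if and only if one is obtained from the other by adding or deleting a single vertex. -}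

module Defs where

open import Data.Nat using (ℕ; zero; suc; _+_; _*_; _≤_)
open import Data.Nat.DivMod using (_mod_)
open import Data.Fin using (Fin; toℕ)
open import Data.Fin.Subset using (Subset; _∈_; _∉_; _⊂_; _∪_; ⁅_⁆; ∣_∣)
open import Data.Product using (Σ; ∃; _×_)
open import Data.Sum using (_⊎_)
open import Relation.Nullary using (¬_)
open import Relation.Binary.PropositionalEquality using (_≡_)
open import Function.Bundles using (_⇔_)

-- Vertices of the cycle C_n are Fin n = {v_0,…,v_{n-1}}; v_i ~ v_{i±1 mod n}.
-- next v_i = v_{i+1 mod n},  prev v_i = v_{i-1 mod n}
next : ∀ {n} → Fin n → Fin n
next {suc m} i = (toℕ i + 1) mod (suc m)

prev : ∀ {n} → Fin n → Fin n
prev {suc m} i = (toℕ i + m) mod (suc m)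

Adj : ∀ {n} → Fin n → Fin n → Set
Adj i j = j ≡ next i ⊎ i ≡ next j

TDS : ∀ {n} → Subset n → Set
TDS {n} S = ∀ (v : Fin n) → ∃ λ u → Adj v u × u ∈ S

MTDS : ∀ {n} → Subset n → Set
MTDS {n} S = TDS S × (∀ (T : Subset n) → T ⊂ S → ¬ TDS T)

MinTDS : ∀ {n} → Subset n → Set
MinTDS {n} S = TDS S × (∀ (T : Subset n) → TDS T → ∣ S ∣ ≤ ∣ T ∣)

-- every component of C_n[S] is a P_2, i.e. every vertex of S has exactly
-- one neighbour (on the cycle) in S
AllP2 : ∀ {n} → Subset n → Set
AllP2 {n} S = ∀ (v : Fin n) → v ∈ S →
  (next v ∈ S × prev v ∉ S) ⊎ (next v ∉ S × prev v ∈ S)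

P2MTDS : ∀ {n} → Subset n → Set
P2MTDS S = MTDS S × AllP2 S

-- v is the first vertex of a P_2 component {v, v+1} of C_n[S] that is
-- followed by exactly one vertex not in S (a P_2 P̄_1 component)
P2P1Start : ∀ {n} → Subset n → Fin n → Set
P2P1Start S v =
  prev v ∉ S × v ∈ S × next v ∈ S × next (next v) ∉ S × next (next (next v)) ∈ S

HasP2P1Count : ∀ {n} → Subset n → ℕ → Set
HasP2P1Count {n} S c =
  Σ (Subset n) λ F → ∣ F ∣ ≡ c × (∀ (v : Fin n) → (v ∈ F ⇔ P2P1Start S v))

InD : ∀ {n} → ℕ → Subset n → Set
InD k S = TDS S × ∣ S ∣ ≤ k

AddOne : ∀ {n} → Subset n → Subset n → Set
AddOne S T = ∃ λ v → v ∉ S × T ≡ S ∪ ⁅ v ⁆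

DEdge : ∀ {n} → Subset n → Subset n → Set
DEdge S T = AddOne S T ⊎ AddOne T S

data DPath {n : ℕ} (k : ℕ) : Subset n → Subset n → Set where
  here : ∀ {S} → InD k S → DPath k S S
  step : ∀ {S S′ T} → InD k S → DEdge S S′ → DPath k S′ T → DPath k S T

Disconnected : ℕ → ℕ → Set
Disconnected n k =
  Σ (Subset n) λ S → Σ (Subset n) λ T → InD k S × InD k T × ¬ DPath k S T

module Submission where

-- The neighbours of an even vertex are odd and vice versa, so
-- S is a TDS iff its even part and its odd part are vertex covers of two cycles C_{2k}
-- ("classes"); a cover of C_{2k} is in turn read on the k pairs (2i, 2i+1).
-- (iii) Changing one class at one position, with the other class fixed, is a step of D_m.
--   Sweeping the pairs of a cover one by one (first adding, then removing a vertex) moves it to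
--   one of the two minimum covers of C_{2k} without exceeding its size by more than one, and
--   the two minimum covers are joined through covers of size at most k + 2. So every TDS with
--   fewer than m vertices reaches A0 = {v_i : i ≡ 0, 1 (mod 4)} in D_m when m ≥ 2k + 2.
-- (i) A0 is rigid: for k ≥ 2 a TDS inside A0 plus one vertex contains A0. So the component
--   of A0 in D_{2k+1} consists of A0 plus at most one vertex and misses {v_i : i ≡ 2, 3 (mod 4)}.
-- (ii) S* is given explicitly and its properties are checked on the indices.

open import Defs
open import Data.Nat using (ℕ; zero; suc; _+_; _*_; _≤_; _<_; z≤n; s≤s; pred; _<ᵇ_; _<?_; _≟_)
open import Data.Nat.Properties
open import Data.Nat.DivMod using (_%_; m<n⇒m%n≡m; n%n≡0; [m+n]%n≡m%n)
open import Data.Nat.Tactic.RingSolver using (solve-∀)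
open import Data.Bool using (Bool; true; false; _∨_; if_then_else_)
open import Data.Fin using (Fin; toℕ; fromℕ<) renaming (zero to fzero)
open import Data.Fin.Properties using (toℕ-fromℕ<; fromℕ<-toℕ; toℕ-injective; toℕ<n)
open import Data.Fin.Subset using (Subset; _∈_; _∉_; _⊆_; _⊂_; _∪_; ⁅_⁆; ∣_∣)
open import Data.Fin.Subset.Properties using (⊆-antisym; x∈p∪q⁺; x∈p∪q⁻; x∈⁅x⁆; x∈⁅y⁆⇒x≡y; p⊆p∪q; p⊂q⇒∣p∣<∣q∣; _∈?_)
open import Data.Vec using (lookup; tabulate)
open import Data.Vec.Properties using (lookup∘tabulate; tabulate∘lookup; tabulate-cong; []=⇒lookup; lookup⇒[]=)
open import Data.Product using (Σ; _×_; _,_; proj₁; proj₂)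
open import Data.Sum using (_⊎_; inj₁; inj₂)
open import Function.Bundles using (mk⇔)
open import Relation.Nullary using (¬_; yes; no; contradiction)
open import Relation.Binary.PropositionalEquality

bit : Bool → ℕ
bit true = 1
bit false = 0

count : ℕ → (ℕ → Bool) → ℕ
count zero h = 0
count (suc n) h = bit (h 0) + count n (λ i → h (suc i))

∨-inl : ∀ {a} b → a ≡ true → a ∨ b ≡ true
∨-inl b refl = refl

∨-inr : ∀ a {b} → b ≡ true → a ∨ b ≡ true
∨-inr true _ = refl
∨-inr false e = e

∨-cases : ∀ {a b} → a ∨ b ≡ true → a ≡ true ⊎ b ≡ true
∨-cases {true} _ = inj₁ refl
∨-cases {false} e = inj₂ e

∨-mono : ∀ {a a′ b b′} → (a ≡ true → a′ ≡ true) → (b ≡ true → b′ ≡ true) → a ∨ b ≡ true → a′ ∨ b′ ≡ true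
∨-mono {a′ = a′} {b′ = b′} fa fb e with ∨-cases e
... | inj₁ x = ∨-inl b′ (fa x)
... | inj₂ x = ∨-inr a′ (fb x)

bits-or : ∀ {a b} → a ∨ b ≡ true → 1 ≤ bit a + bit b
bits-or {true} _ = s≤s z≤n
bits-or {false} {true} _ = s≤s z≤n

Agree : ℕ → (ℕ → Bool) → (ℕ → Bool) → Set
Agree n h h′ = ∀ i → i < n → h i ≡ h′ i

AgreeExcept : ℕ → ℕ → (ℕ → Bool) → (ℕ → Bool) → Set
AgreeExcept n p h h′ = ∀ i → i < n → i ≢ p → h i ≡ h′ i

Below : ℕ → (ℕ → Bool) → (ℕ → Bool) → Set
Below n h h′ = ∀ i → i < n → h i ≡ true → h′ i ≡ true

except-sym : ∀ {n p h h′} → AgreeExcept n p h h′ → AgreeExcept n p h′ h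
except-sym ag i i<n i≢p = sym (ag i i<n i≢p)

except⇒agree : ∀ {n p h h′} → AgreeExcept n p h h′ → h p ≡ h′ p → Agree n h h′
except⇒agree {p = p} ag eq i i<n with i ≟ p
... | yes refl = eq
... | no i≢p = ag i i<n i≢p

count-cong : ∀ n {h h′} → Agree n h h′ → count n h ≡ count n h′
count-cong zero _ = refl
count-cong (suc n) ag = cong₂ _+_ (cong bit (ag 0 (s≤s z≤n))) (count-cong n (λ i l → ag (suc i) (s≤s l)))

count-true : ∀ n → count n (λ _ → true) ≡ n
count-true zero = refl
count-true (suc n) = cong suc (count-true n)

count-false : ∀ n → count n (λ _ → false) ≡ 0
count-false zero = refl
count-false (suc n) = count-false n

count-except : ∀ n {p h h′} → AgreeExcept n p h h′ → count n h′ ≤ suc (count n h)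
count-except zero _ = z≤n
count-except (suc n) {zero} {h} {h′} ag = begin
  bit (h′ 0) + count n (λ i → h′ (suc i)) ≡⟨ cong (bit (h′ 0) +_) (count-cong n (λ i l → sym (ag (suc i) (s≤s l) λ ()))) ⟩
  bit (h′ 0) + count n (λ i → h (suc i))  ≤⟨ +-monoˡ-≤ _ (bit≤1 (h′ 0)) ⟩
  suc (count n (λ i → h (suc i)))         ≤⟨ s≤s (m≤n+m _ (bit (h 0))) ⟩
  suc (bit (h 0) + count n (λ i → h (suc i))) ∎
  where
  open ≤-Reasoning
  bit≤1 : ∀ b → bit b ≤ 1
  bit≤1 true = ≤-refl
  bit≤1 false = z≤n
count-except (suc n) {suc p} {h} {h′} ag =
  subst (_≤ suc (bit (h 0) + count n (λ i → h (suc i))))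
    (cong (λ b → bit b + count n (λ i → h′ (suc i))) (ag 0 (s≤s z≤n) λ ()))
    (≤-trans (+-monoʳ-≤ (bit (h 0)) (count-except n (λ i l ne → ag (suc i) (s≤s l) (λ e → ne (suc-injective e)))))
             (≤-reflexive (+-suc (bit (h 0)) _)))

count-pair : ∀ n {a b a′ b′} → (∀ i → i < n → bit (a′ i) + bit (b′ i) ≤ bit (a i) + bit (b i)) →
  count n a′ + count n b′ ≤ count n a + count n b
count-pair zero _ = z≤n
count-pair (suc n) {a} {b} {a′} {b′} le = begin
  (bit (a′ 0) + count n (λ i → a′ (suc i))) + (bit (b′ 0) + count n (λ i → b′ (suc i)))
    ≡⟨ regroup (bit (a′ 0)) _ (bit (b′ 0)) _ ⟩
  (bit (a′ 0) + bit (b′ 0)) + (count n (λ i → a′ (suc i)) + count n (λ i → b′ (suc i)))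
    ≤⟨ +-mono-≤ (le 0 (s≤s z≤n)) (count-pair n (λ i l → le (suc i) (s≤s l))) ⟩
  (bit (a 0) + bit (b 0)) + (count n (λ i → a (suc i)) + count n (λ i → b (suc i)))
    ≡⟨ sym (regroup (bit (a 0)) _ (bit (b 0)) _) ⟩
  (bit (a 0) + count n (λ i → a (suc i))) + (bit (b 0) + count n (λ i → b (suc i))) ∎
  where
  open ≤-Reasoning
  regroup : ∀ w x y z → (w + x) + (y + z) ≡ (w + y) + (x + z)
  regroup = solve-∀

csuc : ℕ → ℕ → ℕ
csuc n i = if suc i <ᵇ n then suc i else 0

cpred : ℕ → ℕ → ℕ
cpred n zero = pred n
cpred n (suc i) = i

<ᵇ-true : ∀ {m n} → m < n → (m <ᵇ n) ≡ true
<ᵇ-true {zero} (s≤s _) = refl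
<ᵇ-true {suc m} {suc n} (s≤s m<n) = <ᵇ-true m<n

<ᵇ-false : ∀ {m n} → n ≤ m → (m <ᵇ n) ≡ false
<ᵇ-false {m} {zero} _ = refl
<ᵇ-false {suc m} {suc n} (s≤s n≤m) = <ᵇ-false n≤m

csuc-inner : ∀ {n i} → suc i < n → csuc n i ≡ suc i
csuc-inner {n} {i} lt rewrite <ᵇ-true lt = refl

csuc-last : ∀ {n i} → suc i ≡ n → csuc n i ≡ 0
csuc-last {n} {i} refl rewrite <ᵇ-false {suc i} {suc i} ≤-refl = refl

csuc-cases : ∀ {n i} → i < n → (suc i < n × csuc n i ≡ suc i) ⊎ (suc i ≡ n × csuc n i ≡ 0)
csuc-cases i<n with m≤n⇒m<n∨m≡n i<n
... | inj₁ lt = inj₁ (lt , csuc-inner lt)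
... | inj₂ eq = inj₂ (eq , csuc-last eq)

csuc<n : ∀ {n i} → i < n → csuc n i < n
csuc<n i<n with csuc-cases i<n
... | inj₁ (lt , e) = subst (_< _) (sym e) lt
... | inj₂ (_ , e) = subst (_< _) (sym e) (≤-trans (s≤s z≤n) i<n)

cpred<n : ∀ {n i} → i < n → cpred n i < n
cpred<n {suc n} {zero} _ = ≤-refl
cpred<n {n} {suc i} lt = ≤-trans (n≤1+n (suc i)) lt

cpred-csuc : ∀ {n i} → i < n → cpred n (csuc n i) ≡ i
cpred-csuc i<n with csuc-cases i<n
... | inj₁ (_ , e) = cong (cpred _) e
... | inj₂ (eq , e) = trans (cong (cpred _) e) (cong pred (sym eq))

csuc-cpred : ∀ {n i} → i < n → csuc n (cpred n i) ≡ i
csuc-cpred {suc n} {zero} _ = csuc-last refl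
csuc-cpred {n} {suc i} lt = csuc-inner lt

cpred-irrefl : ∀ {n i} → 2 ≤ n → cpred n i ≢ i
cpred-irrefl {suc zero} {zero} (s≤s ())
cpred-irrefl {suc (suc n)} {zero} _ ()
cpred-irrefl {n} {suc i} _ e = m≢1+m+n i (trans e (sym (+-identityʳ (suc i))))

%-csuc : ∀ {n i} → i < suc n → (i + 1) % suc n ≡ csuc (suc n) i
%-csuc {n} {i} i<n with csuc-cases i<n
... | inj₁ (lt , e) = trans (m<n⇒m%n≡m (subst (_< suc n) (sym (+-comm i 1)) lt)) (trans (+-comm i 1) (sym e))
... | inj₂ (eq , e) = trans (cong (_% suc n) (trans (+-comm i 1) eq)) (trans (n%n≡0 (suc n)) (sym e))

%-cpred : ∀ {m i} → i < suc m → (i + m) % suc m ≡ cpred (suc m) i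
%-cpred {m} {zero} _ = m<n⇒m%n≡m ≤-refl
%-cpred {m} {suc i} lt =
  trans (cong (_% suc m) (sym (+-suc i m))) (trans ([m+n]%n≡m%n i (suc m)) (m<n⇒m%n≡m (≤-trans (n≤1+n (suc i)) lt)))

toℕ-next : ∀ {n} (v : Fin n) → toℕ (next v) ≡ csuc n (toℕ v)
toℕ-next {suc n} v = trans (toℕ-fromℕ< _) (%-csuc (toℕ<n v))

toℕ-prev : ∀ {n} (v : Fin n) → toℕ (prev v) ≡ cpred n (toℕ v)
toℕ-prev {suc n} v = trans (toℕ-fromℕ< _) (%-cpred (toℕ<n v))

next-prev : ∀ {n} (v : Fin n) → next (prev v) ≡ v
next-prev {n} v = toℕ-injective (trans (toℕ-next (prev v)) (trans (cong (csuc n) (toℕ-prev v)) (csuc-cpred (toℕ<n v))))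

prev-next : ∀ {n} (v : Fin n) → prev (next v) ≡ v
prev-next {n} v = toℕ-injective (trans (toℕ-prev (next v)) (trans (cong (cpred n) (toℕ-next v)) (cpred-csuc (toℕ<n v))))

TDS⇒nbr : ∀ {n} {S : Subset n} → TDS S → ∀ v → next v ∈ S ⊎ prev v ∈ S
TDS⇒nbr tds v with tds v
... | u , inj₁ refl , u∈S = inj₁ u∈S
... | u , inj₂ refl , u∈S = inj₂ (subst (_∈ _) (sym (prev-next u)) u∈S)

nbr⇒TDS : ∀ {n} {S : Subset n} → (∀ v → next v ∈ S ⊎ prev v ∈ S) → TDS S
nbr⇒TDS nbr v with nbr v
... | inj₁ x = next v , inj₁ refl , x
... | inj₂ x = prev v , inj₂ (sym (next-prev v)) , x

toSub : ∀ {n} → (ℕ → Bool) → Subset n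
toSub h = tabulate (λ v → h (toℕ v))

∈toSub : ∀ {n} h {v : Fin n} → v ∈ toSub h → h (toℕ v) ≡ true
∈toSub h {v} v∈ = trans (sym (lookup∘tabulate _ v)) ([]=⇒lookup v∈)

toSub∈ : ∀ {n} h {v : Fin n} → h (toℕ v) ≡ true → v ∈ toSub h
toSub∈ h {v} e = lookup⇒[]= v (toSub h) (trans (lookup∘tabulate _ v) e)

∈-at : ∀ {n} h {v : Fin n} {i} → toℕ v ≡ i → v ∈ toSub h → h i ≡ true
∈-at h refl = ∈toSub h

at-∈ : ∀ {n} h {v : Fin n} {i} → toℕ v ≡ i → h i ≡ true → v ∈ toSub h
at-∈ h refl = toSub∈ h

∉-at : ∀ {n} h {v : Fin n} {i} → toℕ v ≡ i → v ∉ toSub h → h i ≡ false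
∉-at h {v} refl v∉ with h (toℕ v) in e
... | true = contradiction (toSub∈ h e) v∉
... | false = refl

at-∉ : ∀ {n} h {v : Fin n} {i} → toℕ v ≡ i → h i ≡ false → v ∉ toSub h
at-∉ h refl e v∈ = contradiction (trans (sym e) (∈toSub h v∈)) λ ()

∣toSub∣ : ∀ n h → ∣ toSub {n} h ∣ ≡ count n h
∣toSub∣ zero h = refl
∣toSub∣ (suc n) h with h 0 | ∣toSub∣ n (λ i → h (suc i))
... | true | e = cong suc e
... | false | e = e

toSub-cong : ∀ {n h h′} → Agree n h h′ → toSub {n} h ≡ toSub h′
toSub-cong ag = tabulate-cong (λ v → ag (toℕ v) (toℕ<n v))

toSub-mono : ∀ {n h h′} → Below n h h′ → toSub {n} h ⊆ toSub h′
toSub-mono {h = h} {h′} below {v} v∈ = toSub∈ h′ (below (toℕ v) (toℕ<n v) (∈toSub h v∈))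

at : ∀ {n} → Subset n → ℕ → Bool
at {n} S i with i <? n
... | yes i<n = lookup S (fromℕ< i<n)
... | no _ = false

toSub-at : ∀ {n} (S : Subset n) → toSub (at S) ≡ S
toSub-at {n} S = trans (tabulate-cong at-toℕ) (tabulate∘lookup S)
  where
  at-toℕ : ∀ v → at S (toℕ v) ≡ lookup S v
  at-toℕ v with toℕ v <? n
  ... | yes l = cong (lookup S) (fromℕ<-toℕ v l)
  ... | no ¬l = contradiction (toℕ<n v) ¬l

addAt : ∀ {n p h h′} (p<n : p < n) → AgreeExcept n p h h′ → h p ≡ false → h′ p ≡ true →
  AddOne (toSub {n} h) (toSub h′)
addAt {n} {p} {h} {h′} p<n ag hp h′p = v , v∉ , ⊆-antisym grow shrink
  where
  v : Fin n
  v = fromℕ< p<n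
  v∉ : v ∉ toSub h
  v∉ v∈ with trans (sym hp) (subst (λ i → h i ≡ true) (toℕ-fromℕ< p<n) (∈toSub h v∈))
  ... | ()
  grow : toSub h′ ⊆ toSub h ∪ ⁅ v ⁆
  grow {u} u∈ with toℕ u ≟ p
  ... | yes refl = x∈p∪q⁺ (inj₂ (subst (_∈ ⁅ v ⁆) (toℕ-injective (toℕ-fromℕ< p<n)) (x∈⁅x⁆ v)))
  ... | no u≢p = x∈p∪q⁺ (inj₁ (toSub∈ h (trans (ag (toℕ u) (toℕ<n u) u≢p) (∈toSub h′ u∈))))
  shrink : toSub h ∪ ⁅ v ⁆ ⊆ toSub h′
  shrink {u} u∈ with x∈p∪q⁻ (toSub h) ⁅ v ⁆ u∈
  ... | inj₂ u∈v rewrite x∈⁅y⁆⇒x≡y v u∈v = toSub∈ h′ (subst (λ i → h′ i ≡ true) (sym (toℕ-fromℕ< p<n)) h′p)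
  ... | inj₁ u∈h with toℕ u ≟ p
  ...   | yes refl = toSub∈ h′ h′p
  ...   | no u≢p = toSub∈ h′ (trans (sym (ag (toℕ u) (toℕ<n u) u≢p)) (∈toSub h u∈h))

NbrCov : ℕ → (ℕ → Bool) → Set
NbrCov n h = ∀ i → i < n → h (cpred n i) ∨ h (csuc n i) ≡ true

TDS⇒nbrCov : ∀ {n} h → TDS (toSub {n} h) → NbrCov n h
TDS⇒nbrCov {n} h tds i i<n with TDS⇒nbr tds (fromℕ< i<n)
... | inj₁ x = ∨-inr _ (subst (λ j → h j ≡ true) (trans (toℕ-next _) (cong (csuc n) (toℕ-fromℕ< i<n))) (∈toSub h x))
... | inj₂ x = ∨-inl _ (subst (λ j → h j ≡ true) (trans (toℕ-prev _) (cong (cpred n) (toℕ-fromℕ< i<n))) (∈toSub h x))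

nbrCov⇒TDS : ∀ {n} h → NbrCov n h → TDS (toSub {n} h)
nbrCov⇒TDS {n} h cov = nbr⇒TDS nbr
  where
  nbr : ∀ v → next v ∈ toSub h ⊎ prev v ∈ toSub h
  nbr v with ∨-cases (cov (toℕ v) (toℕ<n v))
  ... | inj₁ x = inj₂ (toSub∈ h (subst (λ j → h j ≡ true) (sym (toℕ-prev v)) x))
  ... | inj₂ x = inj₁ (toSub∈ h (subst (λ j → h j ≡ true) (sym (toℕ-next v)) x))

dhead : ∀ {n m} {S T : Subset n} → DPath m S T → InD m S
dhead (here i) = i
dhead (step i _ _) = i

dcat : ∀ {n m} {S T U : Subset n} → DPath m S T → DPath m T U → DPath m S U
dcat (here _) q = q
dcat (step i e p) q = step i e (dcat p q)

edge-sym : ∀ {n} {S T : Subset n} → DEdge S T → DEdge T S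
edge-sym (inj₁ x) = inj₂ x
edge-sym (inj₂ x) = inj₁ x

drev : ∀ {n m} {S T : Subset n} → DPath m S T → DPath m T S
drev (here i) = here i
drev (step i e p) = dcat (drev p) (step (dhead p) (edge-sym e) (here i))

flipStep : ∀ {n m p h h′} {U : Subset n} → p < n → AgreeExcept n p h h′ →
  InD m (toSub {n} h) → InD m (toSub {n} h′) → DPath m (toSub h′) U → DPath m (toSub h) U
flipStep {m = m} {p} {h} {h′} {U} p<n ag inD inD′ path with h p in hp | h′ p in h′p
... | false | true = step inD (inj₁ (addAt {h = h} {h′} p<n ag hp h′p)) path
... | true | false = step inD (inj₂ (addAt {h = h′} {h} p<n (except-sym ag) h′p hp)) path
... | false | false = subst (λ S → DPath m S U) (sym (toSub-cong {h = h} {h′} (except⇒agree ag (trans hp (sym h′p))))) path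
... | true | true = subst (λ S → DPath m S U) (sym (toSub-cong {h = h} {h′} (except⇒agree ag (trans hp (sym h′p))))) path

-- weave f g interleaves two sequences: f on the even positions, g on the odd ones
weave : (ℕ → Bool) → (ℕ → Bool) → ℕ → Bool
weave f g zero = f 0
weave f g (suc i) = weave g (λ j → f (suc j)) i

evens : (ℕ → Bool) → ℕ → Bool
evens h j = h (j * 2)

odds : (ℕ → Bool) → ℕ → Bool
odds h j = h (suc (j * 2))

weave-even : ∀ f g j → weave f g (j * 2) ≡ f j
weave-even f g zero = refl
weave-even f g (suc j) = weave-even (λ i → f (suc i)) (λ i → g (suc i)) j

weave-odd : ∀ f g j → weave f g (suc (j * 2)) ≡ g j
weave-odd f g zero = refl
weave-odd f g (suc j) = weave-odd (λ i → f (suc i)) (λ i → g (suc i)) j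

weave-split : ∀ h i → weave (evens h) (odds h) i ≡ h i
weave-split h zero = refl
weave-split h (suc i) = weave-split (λ j → h (suc j)) i

data Parity (L : ℕ) : ℕ → Set where
  even : ∀ {j} → j < L → Parity L (j * 2)
  odd : ∀ {j} → j < L → Parity L (suc (j * 2))

parity : ∀ L {i} → i < L * 2 → Parity L i
parity (suc L) {zero} _ = even (s≤s z≤n)
parity (suc L) {suc zero} _ = odd (s≤s z≤n)
parity (suc L) {suc (suc i)} (s≤s (s≤s lt)) with parity L lt
... | even j<L = even (s≤s j<L)
... | odd j<L = odd (s≤s j<L)

weave-agree : ∀ {L f f′ g g′} → Agree L f f′ → Agree L g g′ → Agree (L * 2) (weave f g) (weave f′ g′)
weave-agree {L} {f = f} {f′} {g} {g′} af ag i i< with parity L i<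
... | even {j} j< = trans (weave-even f g j) (trans (af j j<) (sym (weave-even f′ g′ j)))
... | odd {j} j< = trans (weave-odd f g j) (trans (ag j j<) (sym (weave-odd f′ g′ j)))

weave-below : ∀ {L f f′ g g′} → Below L f f′ → Below L g g′ → Below (L * 2) (weave f g) (weave f′ g′)
weave-below {L} {f = f} {f′} {g} {g′} bf bg i i< with parity L i<
... | even {j} j< = λ e → trans (weave-even f′ g′ j) (bf j j< (trans (sym (weave-even f g j)) e))
... | odd {j} j< = λ e → trans (weave-odd f′ g′ j) (bg j j< (trans (sym (weave-odd f g j)) e))

weave-exceptˡ : ∀ {L p f f′} g → AgreeExcept L p f f′ → AgreeExcept (L * 2) (p * 2) (weave f g) (weave f′ g)
weave-exceptˡ {L} {f = f} {f′} g ag i i< i≢ with parity L i<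
... | even {j} j< = trans (weave-even f g j) (trans (ag j j< (λ e → i≢ (cong (_* 2) e))) (sym (weave-even f′ g j)))
... | odd {j} j< = trans (weave-odd f g j) (sym (weave-odd f′ g j))

weave-exceptʳ : ∀ {L p g g′} f → AgreeExcept L p g g′ → AgreeExcept (L * 2) (suc (p * 2)) (weave f g) (weave f g′)
weave-exceptʳ {L} {g = g} {g′} f ag i i< i≢ with parity L i<
... | even {j} j< = trans (weave-even f g j) (sym (weave-even f g′ j))
... | odd {j} j< = trans (weave-odd f g j) (trans (ag j j< (λ e → i≢ (cong (λ x → suc (x * 2)) e))) (sym (weave-odd f g′ j)))

count-weave : ∀ L f g → count (L * 2) (weave f g) ≡ count L f + count L g
count-weave zero f g = refl
count-weave (suc L) f g =
  trans (cong (λ c → bit (f 0) + (bit (g 0) + c)) (count-weave L (λ j → f (suc j)) (λ j → g (suc j))))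
        (regroup (bit (f 0)) (bit (g 0)) (count L (λ j → f (suc j))) (count L (λ j → g (suc j))))
  where
  regroup : ∀ a b c d → a + (b + (c + d)) ≡ (a + c) + (b + d)
  regroup = solve-∀

count-split : ∀ L h → count (L * 2) h ≡ count L (evens h) + count L (odds h)
count-split L h = trans (sym (count-cong (L * 2) (λ i _ → weave-split h i))) (count-weave L (evens h) (odds h))

even< : ∀ {L j} → j < L → j * 2 < L * 2
even< j<L = ≤-trans (n≤1+n _) (*-monoˡ-≤ 2 j<L)

odd< : ∀ {L j} → j < L → suc (j * 2) < L * 2
odd< j<L = *-monoˡ-≤ 2 j<L

csuc-even : ∀ {L j} → j < L → csuc (L * 2) (j * 2) ≡ suc (j * 2)
csuc-even j<L = csuc-inner (odd< j<L)

csuc-odd : ∀ {L j} → j < L → csuc (L * 2) (suc (j * 2)) ≡ csuc L j * 2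
csuc-odd j<L with csuc-cases j<L
... | inj₁ (lt , e) = trans (csuc-inner (≤-trans (n≤1+n _) (*-monoˡ-≤ 2 lt))) (cong (_* 2) (sym e))
... | inj₂ (eq , e) = trans (csuc-last (cong (_* 2) eq)) (cong (_* 2) (sym e))

cpred-even : ∀ L j → cpred (suc L * 2) (j * 2) ≡ suc (cpred (suc L) j * 2)
cpred-even L zero = refl
cpred-even L (suc j) = refl

VC : ℕ → (ℕ → Bool) → Set
VC L x = ∀ j → j < L → x j ∨ x (csuc L j) ≡ true

VC-back : ∀ {L x} → VC L x → ∀ j → j < L → x (cpred L j) ∨ x j ≡ true
VC-back {L} {x} vc j j< = subst (λ i → x (cpred L j) ∨ x i ≡ true) (csuc-cpred j<) (vc (cpred L j) (cpred<n j<))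

VC-fwd : ∀ {L x} → (∀ j → j < L → x (cpred L j) ∨ x j ≡ true) → VC L x
VC-fwd {L} {x} back j j< = subst (λ i → x i ∨ x (csuc L j) ≡ true) (cpred-csuc j<) (back (csuc L j) (csuc<n j<))

VC-cong : ∀ {L x y} → Agree L x y → VC L x → VC L y
VC-cong {L} ag vc j j< = subst₂ (λ a b → a ∨ b ≡ true) (ag j j<) (ag (csuc L j) (csuc<n j<)) (vc j j<)

-- on C_{2L}, the neighbours of odd vertices are even and vice versa: total domination of C_{2L}
-- is covering both cycles C_L formed by the even and by the odd vertices
nbrCov⇒VC : ∀ L h → NbrCov (suc L * 2) h → VC (suc L) (evens h) × VC (suc L) (odds h)
nbrCov⇒VC L h cov = evenClass , VC-fwd {x = odds h} oddClass
  where
  evenClass : VC (suc L) (evens h)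
  evenClass j j< = subst (λ i → h (j * 2) ∨ h i ≡ true) (csuc-odd j<) (cov (suc (j * 2)) (odd< j<))
  oddClass : ∀ j → j < suc L → odds h (cpred (suc L) j) ∨ odds h j ≡ true
  oddClass j j< = subst₂ (λ a b → h a ∨ h b ≡ true) (cpred-even L j) (csuc-even j<) (cov (j * 2) (even< j<))

VC⇒nbrCov : ∀ L f g → VC (suc L) f → VC (suc L) g → NbrCov (suc L * 2) (weave f g)
VC⇒nbrCov L f g vf vg i i< with parity (suc L) i<
... | even {j} j< rewrite cpred-even L j | csuc-even j< | weave-odd f g (cpred (suc L) j) | weave-odd f g j = VC-back {x = g} vg j j<
... | odd {j} j< rewrite csuc-odd j< | weave-even f g j | weave-even f g (csuc (suc L) j) = vf j j<

-- a cover of C_{2k} read on the k pairs (2i, 2i+1): every pair, and every link between the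
-- second vertex of a pair and the first vertex of the next pair, is covered
PairCov : ℕ → (ℕ → Bool) → (ℕ → Bool) → Set
PairCov k a b = (∀ i → i < k → a i ∨ b i ≡ true) × (∀ i → i < k → b i ∨ a (csuc k i) ≡ true)

VC⇒pairCov : ∀ {k x} → VC (k * 2) x → PairCov k (evens x) (odds x)
VC⇒pairCov {k} {x} vc = inside , link
  where
  inside : ∀ i → i < k → x (i * 2) ∨ x (suc (i * 2)) ≡ true
  inside i i< = subst (λ j → x (i * 2) ∨ x j ≡ true) (csuc-even i<) (vc (i * 2) (even< i<))
  link : ∀ i → i < k → x (suc (i * 2)) ∨ x (csuc k i * 2) ≡ true
  link i i< = subst (λ j → x (suc (i * 2)) ∨ x j ≡ true) (csuc-odd i<) (vc (suc (i * 2)) (odd< i<))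

pairCov⇒VC : ∀ {k a b} → PairCov k a b → VC (k * 2) (weave a b)
pairCov⇒VC {k} {a} {b} (inside , link) j j< with parity k j<
... | even {i} i< rewrite csuc-even i< | weave-even a b i | weave-odd a b i = inside i i<
... | odd {i} i< rewrite csuc-odd i< | weave-odd a b i | weave-even a b (csuc k i) = link i i<

PairCov-mono : ∀ {k a a′ b b′} → Below k a a′ → Below k b b′ → PairCov k a b → PairCov k a′ b′
PairCov-mono {k} ba bb (inside , link) =
  (λ i i< → ∨-mono (ba i i<) (bb i i<) (inside i i<)) ,
  (λ i i< → ∨-mono (bb i i<) (ba (csuc k i) (csuc<n i<)) (link i i<))

Valid : ℕ → ℕ → (ℕ → Bool) → Set
Valid L b x = VC L x × count L x ≤ b

Valid-cong : ∀ {L b x y} → Agree L x y → Valid L b x → Valid L b y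
Valid-cong {L} {b} ag (vc , c) = VC-cong ag vc , subst (_≤ b) (count-cong L ag) c

data Walk (L b : ℕ) : (ℕ → Bool) → (ℕ → Bool) → Set where
  stop : ∀ {x y} → Valid L b x → Agree L x y → Walk L b x y
  move : ∀ {x y z} j → j < L → Valid L b x → AgreeExcept L j x y → Walk L b y z → Walk L b x z

walk-valid : ∀ {L b x z} → Walk L b x z → Valid L b x
walk-valid (stop v _) = v
walk-valid (move _ _ v _ _) = v

walk-congˡ : ∀ {L b x y z} → Agree L x y → Walk L b y z → Walk L b x z
walk-congˡ ag (stop v a) = stop (Valid-cong (λ i i< → sym (ag i i<)) v) (λ i i< → trans (ag i i<) (a i i<))
walk-congˡ ag (move j j< v e w) =
  move j j< (Valid-cong (λ i i< → sym (ag i i<)) v) (λ i i< ne → trans (ag i i<) (e i i< ne)) w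

walk-congʳ : ∀ {L b x y z} → Walk L b x y → Agree L y z → Walk L b x z
walk-congʳ (stop v a) ag = stop v (λ i i< → trans (a i i<) (ag i i<))
walk-congʳ (move j j< v e w) ag = move j j< v e (walk-congʳ w ag)

walk-weaken : ∀ {L b b′ x y} → b ≤ b′ → Walk L b x y → Walk L b′ x y
walk-weaken b≤ (stop (vc , c) a) = stop (vc , ≤-trans c b≤) a
walk-weaken b≤ (move j j< (vc , c) e w) = move j j< (vc , ≤-trans c b≤) e (walk-weaken b≤ w)

walk-snoc : ∀ {L b x y z j} → Walk L b x y → j < L → AgreeExcept L j y z → Valid L b z → Walk L b x z
walk-snoc {j = j} (stop v a) j< e vz = move j j< v (λ i i< ne → trans (a i i<) (e i i< ne)) (stop vz (λ _ _ → refl))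
walk-snoc (move j′ j′< v e′ w) j< e vz = move j′ j′< v e′ (walk-snoc w j< e vz)

walk-rev : ∀ {L b x y} → Walk L b x y → Walk L b y x
walk-rev (stop v a) = stop (Valid-cong a v) (λ i i< → sym (a i i<))
walk-rev (move j j< v e w) = walk-snoc (walk-rev w) j< (except-sym e) v

liftWalk : ∀ {L b n m} (e : (ℕ → Bool) → ℕ → Bool) (π : ℕ → ℕ) →
  (∀ {j} → j < L → π j < n) →
  (∀ {x y} → Agree L x y → Agree n (e x) (e y)) →
  (∀ {x y j} → AgreeExcept L j x y → AgreeExcept n (π j) (e x) (e y)) →
  (∀ {x} → Valid L b x → InD m (toSub {n} (e x))) →
  ∀ {x z} → Walk L b x z → DPath m (toSub {n} (e x)) (toSub (e z))
liftWalk {m = m} e π π< eA eE eV (stop {x} {y} v a) =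
  subst (DPath m (toSub (e x))) (toSub-cong {h = e x} {e y} (eA a)) (here (eV v))
liftWalk e π π< eA eE eV (move j j< v ex w) =
  flipStep (π< j<) (eE ex) (eV v) (eV (walk-valid w)) (liftWalk e π π< eA eE eV w)

liftˡ : ∀ {L b m g x z} → VC (suc L) g → b + count (suc L) g ≤ m → Walk (suc L) b x z →
  DPath m (toSub {suc L * 2} (weave x g)) (toSub (weave z g))
liftˡ {L} {b} {m} {g} vg bound =
  liftWalk (λ x → weave x g) (_* 2) even< (λ a → weave-agree a (λ _ _ → refl)) (weave-exceptˡ g) (λ {x} → inD {x})
  where
  inD : ∀ {x} → Valid (suc L) b x → InD m (toSub (weave x g))
  inD {x} (vx , cx) = nbrCov⇒TDS (weave x g) (VC⇒nbrCov L x g vx vg) ,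
    subst (_≤ m) (sym (trans (∣toSub∣ (suc L * 2) (weave x g)) (count-weave (suc L) x g))) (≤-trans (+-monoˡ-≤ _ cx) bound)

liftʳ : ∀ {L b m f x z} → VC (suc L) f → count (suc L) f + b ≤ m → Walk (suc L) b x z →
  DPath m (toSub {suc L * 2} (weave f x)) (toSub (weave f z))
liftʳ {L} {b} {m} {f} vf bound =
  liftWalk (weave f) (λ j → suc (j * 2)) odd< (weave-agree (λ _ _ → refl)) (weave-exceptʳ f) (λ {x} → inD {x})
  where
  inD : ∀ {x} → Valid (suc L) b x → InD m (toSub (weave f x))
  inD {x} (vx , cx) = nbrCov⇒TDS (weave f x) (VC⇒nbrCov L f x vf vx) ,
    subst (_≤ m) (sym (trans (∣toSub∣ (suc L * 2) (weave f x)) (count-weave (suc L) f x))) (≤-trans (+-monoʳ-≤ _ cx) bound)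

hyb : (ℕ → Bool) → (ℕ → Bool) → ℕ → ℕ → Bool
hyb t x p i = if i <ᵇ p then t i else x i

hyb-< : ∀ t x {p i} → i < p → hyb t x p i ≡ t i
hyb-< t x lt rewrite <ᵇ-true lt = refl

hyb-≥ : ∀ t x {p i} → p ≤ i → hyb t x p i ≡ x i
hyb-≥ t x le rewrite <ᵇ-false le = refl

hyb-either : ∀ t x {p i} → t i ≡ true → x i ≡ true → hyb t x p i ≡ true
hyb-either t x {p} {i} ti xi with i <ᵇ p
... | true = ti
... | false = xi

hyb-step : ∀ t x L p → AgreeExcept L p (hyb t x p) (hyb t x (suc p))
hyb-step t x L p i _ i≢p with i <? p
... | yes lt = trans (hyb-< t x lt) (sym (hyb-< t x (≤-trans lt (n≤1+n p))))
... | no ¬lt = trans (hyb-≥ t x (≮⇒≥ ¬lt)) (sym (hyb-≥ t x (≤∧≢⇒< (≮⇒≥ ¬lt) (λ e → i≢p (sym e)))))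

hyb-grow : ∀ t x L p → (∀ i → x i ≡ true → t i ≡ true) → Below L (hyb t x p) (hyb t x (suc p))
hyb-grow t x L p x⊆t i _ e with i <? suc p
... | no ¬lt = trans (hyb-≥ t x (≮⇒≥ ¬lt)) (trans (sym (hyb-≥ t x (≤-trans (n≤1+n p) (≮⇒≥ ¬lt)))) e)
... | yes lt with i <? p
...   | yes lt′ = trans (hyb-< t x lt) (trans (sym (hyb-< t x lt′)) e)
...   | no ¬lt′ = trans (hyb-< t x lt) (x⊆t i (trans (sym (hyb-≥ t x (≮⇒≥ ¬lt′))) e))

-- Exchanging the pairs of a cover of C_{2k} one by one: the state (A p, B p) becomes
-- (A (p+1), B (p+1)) by changing A at p and then B at p. If every (A p, B p) is a cover with at
-- most c vertices and B only grows, the walk passes through covers with at most c + 1 vertices.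
ladder : ∀ {k c} (A B : ℕ → ℕ → Bool) →
  (∀ p → AgreeExcept k p (A p) (A (suc p))) →
  (∀ p → AgreeExcept k p (B p) (B (suc p))) →
  (∀ p → Below k (B p) (B (suc p))) →
  (∀ p → PairCov k (A p) (B p)) →
  (∀ p → count k (A p) + count k (B p) ≤ c) →
  ∀ p → p ≤ k → Walk (k * 2) (suc c) (weave (A p) (B p)) (weave (A 0) (B 0))
ladder {k} {c} A B stepA stepB growB cov size = go
  where
  full : ∀ q → Valid (k * 2) (suc c) (weave (A q) (B q))
  full q = pairCov⇒VC (cov q) ,
    subst (_≤ suc c) (sym (count-weave k (A q) (B q))) (≤-trans (size q) (n≤1+n c))
  half : ∀ q → Valid (k * 2) (suc c) (weave (A q) (B (suc q)))
  half q = pairCov⇒VC (PairCov-mono (λ _ _ e → e) (growB q) (cov q)) ,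
    subst (_≤ suc c) (sym (count-weave k (A q) (B (suc q))))
      (≤-trans (+-monoʳ-≤ (count k (A q)) (count-except k (stepB q)))
        (≤-trans (≤-reflexive (+-suc _ _)) (s≤s (size q))))
  go : ∀ p → p ≤ k → Walk (k * 2) (suc c) (weave (A p) (B p)) (weave (A 0) (B 0))
  go zero _ = stop (full 0) (λ _ _ → refl)
  go (suc p) p<k =
    move (p * 2) (even< p<k) (full (suc p)) (weave-exceptˡ (B (suc p)) (except-sym (stepA p)))
      (move (suc (p * 2)) (odd< p<k) (half p) (weave-exceptʳ (A p) (except-sym (stepB p)))
        (go p (≤-trans (n≤1+n p) p<k)))

evenCover : ℕ → Bool
evenCover = weave (λ _ → true) (λ _ → false)

oddCover : ℕ → Bool
oddCover = weave (λ _ → false) (λ _ → true)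

-- Sweeping a cover towards the odd cover from the left: pair p becomes (false, true), adding its
-- second vertex before removing its first. This needs the last vertex of C_{2k} in the cover.
sweepOdd : ∀ {k a b} → PairCov k a b → b (pred k) ≡ true →
  Walk (k * 2) (suc (count k a + count k b)) (weave a b) oddCover
sweepOdd {k} {a} {b} (inside , link) last =
  walk-congʳ (walk-rev (ladder A B (hyb-step ff a k) (hyb-step tt b k) (λ p → hyb-grow tt b k p (λ _ _ → refl))
                                   cov size k ≤-refl))
             (weave-agree {k} (λ i i< → hyb-< ff a i<) (λ i i< → hyb-< tt b i<))
  where
  ff tt : ℕ → Bool
  ff _ = false
  tt _ = true
  A B : ℕ → ℕ → Bool
  A = hyb ff a
  B = hyb tt b
  cov : ∀ p → PairCov k (A p) (B p)
  cov p = inside′ , link′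
    where
    inside′ : ∀ i → i < k → A p i ∨ B p i ≡ true
    inside′ i i< with i <? p
    ... | yes lt rewrite hyb-< ff a lt | hyb-< tt b lt = refl
    ... | no ¬lt rewrite hyb-≥ ff a (≮⇒≥ ¬lt) | hyb-≥ tt b (≮⇒≥ ¬lt) = inside i i<
    link′ : ∀ i → i < k → B p i ∨ A p (csuc k i) ≡ true
    link′ i i< with i <? p
    ... | yes lt rewrite hyb-< tt b lt = refl
    ... | no ¬lt rewrite hyb-≥ tt b (≮⇒≥ ¬lt) with csuc-cases i<
    ...   | inj₁ (_ , e) rewrite e | hyb-≥ ff a (≤-trans (≮⇒≥ ¬lt) (n≤1+n i)) =
      subst (λ j → b i ∨ a j ≡ true) e (link i i<)
    ...   | inj₂ (eq , _) = ∨-inl _ (subst (λ j → b j ≡ true) (cong pred (sym eq)) last)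
  size : ∀ p → count k (A p) + count k (B p) ≤ count k a + count k b
  size p = count-pair k bound
    where
    bound : ∀ i → i < k → bit (A p i) + bit (B p i) ≤ bit (a i) + bit (b i)
    bound i i< with i <? p
    ... | yes lt rewrite hyb-< ff a lt | hyb-< tt b lt = bits-or {a i} {b i} (inside i i<)
    ... | no ¬lt rewrite hyb-≥ ff a (≮⇒≥ ¬lt) | hyb-≥ tt b (≮⇒≥ ¬lt) = ≤-refl

-- Sweeping a cover towards the even cover from the right: pair p becomes (true, false), adding its
-- first vertex before removing its second. This needs the first vertex of C_{2k} in the cover.
sweepEven : ∀ {k a b} → PairCov k a b → a 0 ≡ true →
  Walk (k * 2) (suc (count k a + count k b)) (weave a b) evenCover
sweepEven {k} {a} {b} (inside , link) first =
  walk-congˡ (weave-agree {k} (λ i i< → sym (hyb-< a tt i<)) (λ i i< → sym (hyb-< b ff i<)))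
    (ladder A B (hyb-step a tt k) (hyb-step b ff k) (λ p → hyb-grow b ff k p (λ _ ())) cov size k ≤-refl)
  where
  ff tt : ℕ → Bool
  ff _ = false
  tt _ = true
  A B : ℕ → ℕ → Bool
  A = hyb a tt
  B = hyb b ff
  cov : ∀ p → PairCov k (A p) (B p)
  cov p = inside′ , link′
    where
    inside′ : ∀ i → i < k → A p i ∨ B p i ≡ true
    inside′ i i< with i <? p
    ... | yes lt rewrite hyb-< a tt lt | hyb-< b ff lt = inside i i<
    ... | no ¬lt rewrite hyb-≥ a tt (≮⇒≥ ¬lt) = refl
    link′ : ∀ i → i < k → B p i ∨ A p (csuc k i) ≡ true
    link′ i i< with i <? p
    ... | yes lt rewrite hyb-< b ff lt = ∨-mono (λ e → e) (λ e → hyb-either a tt {p} e refl) (link i i<)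
    ... | no ¬lt with csuc-cases i<
    ...   | inj₁ (_ , e) rewrite e = ∨-inr (B p i) (hyb-≥ a tt {p} (≤-trans (≮⇒≥ ¬lt) (n≤1+n i)))
    ...   | inj₂ (_ , e) rewrite e = ∨-inr (B p i) (hyb-either a tt {p} first refl)
  size : ∀ p → count k (A p) + count k (B p) ≤ count k a + count k b
  size p = count-pair k bound
    where
    bound : ∀ i → i < k → bit (A p i) + bit (B p i) ≤ bit (a i) + bit (b i)
    bound i i< with i <? p
    ... | yes lt rewrite hyb-< a tt lt | hyb-< b ff lt = ≤-refl
    ... | no ¬lt rewrite hyb-≥ a tt (≮⇒≥ ¬lt) | hyb-≥ b ff (≮⇒≥ ¬lt) = bits-or {a i} {b i} (inside i i<)

alt : Bool → ℕ → Bool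
alt true = evenCover
alt false = oddCover

alt-VC : ∀ k c → VC (k * 2) (alt c)
alt-VC k true = pairCov⇒VC {k} ((λ _ _ → refl) , (λ _ _ → refl))
alt-VC k false = pairCov⇒VC {k} ((λ _ _ → refl) , (λ _ _ → refl))

count-alt : ∀ k c → count (k * 2) (alt c) ≡ k
count-alt k true = trans (count-weave k _ _) (trans (cong₂ _+_ (count-true k) (count-false k)) (+-identityʳ k))
count-alt k false = trans (count-weave k _ _) (cong₂ _+_ (count-false k) (count-true k))

VC-size : ∀ {k x} → VC (k * 2) x → k ≤ count (k * 2) x
VC-size {k} {x} vc = begin
  k                                       ≡⟨ sym (count-alt k false) ⟩
  count (k * 2) oddCover                  ≡⟨ count-weave k _ _ ⟩
  count k (λ _ → false) + count k (λ _ → true) ≤⟨ count-pair k (λ i i< → bits-or {evens x i} {odds x i} (proj₁ (VC⇒pairCov {k} {x} vc) i i<)) ⟩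
  count k (evens x) + count k (odds x)    ≡⟨ sym (count-split k x) ⟩
  count (k * 2) x                         ∎
  where open ≤-Reasoning

toAlt : ∀ {k x} → 0 < k → VC (k * 2) x → Σ Bool λ c → Walk (k * 2) (suc (count (k * 2) x)) x (alt c)
toAlt {suc k′} {x} _ vc with VC⇒pairCov {suc k′} {x} vc
... | cov@(_ , link) with ∨-cases (link k′ ≤-refl)
...   | inj₁ last = false , walk-congˡ split (walk-weaken size (sweepOdd {suc k′} cov last))
  where
  split : Agree (suc k′ * 2) x (weave (evens x) (odds x))
  split i _ = sym (weave-split x i)
  size : suc (count (suc k′) (evens x) + count (suc k′) (odds x)) ≤ suc (count (suc k′ * 2) x)
  size = ≤-reflexive (cong suc (sym (count-split (suc k′) x)))
...   | inj₂ first = true , walk-congˡ split (walk-weaken size (sweepEven {suc k′} cov first′))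
  where
  split : Agree (suc k′ * 2) x (weave (evens x) (odds x))
  split i _ = sym (weave-split x i)
  size : suc (count (suc k′) (evens x) + count (suc k′) (odds x)) ≤ suc (count (suc k′ * 2) x)
  size = ≤-reflexive (cong suc (sym (count-split (suc k′) x)))
  first′ : evens x 0 ≡ true
  first′ = subst (λ j → evens x j ≡ true) (csuc-last {suc k′} {k′} refl) first

toEven : ∀ {k} → 0 < k → ∀ c → Walk (k * 2) (k + 2) (alt c) evenCover
toEven {k} _ true = stop (alt-VC k true , ≤-trans (≤-reflexive (count-alt k true)) (m≤m+n k 2)) (λ _ _ → refl)
toEven {suc k′} _ false =
  move 0 (s≤s z≤n) (alt-VC k false , ≤-trans (≤-reflexive (count-alt k false)) (m≤m+n k 2))
    (weave-exceptˡ tt (hyb-step tt ff k 0))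
    (walk-weaken (≤-reflexive size) (sweepEven {k} ((λ i _ → ∨-inr (hyb tt ff 1 i) refl) , (λ _ _ → refl)) refl))
  where
  k = suc k′
  ff tt : ℕ → Bool
  ff _ = false
  tt _ = true
  size : suc (count k (hyb tt ff 1) + count k tt) ≡ k + 2
  size = trans (cong (λ c → suc (suc c + count k tt)) (count-false k′)) (trans (cong (λ c → suc (suc c)) (count-true k)) (+-comm 2 k))

-- a0 describes the vertex set {v_i : i ≡ 0, 1 (mod 4)}: the even cover in both classes
a0 : ℕ → Bool
a0 = weave evenCover evenCover

A0 : ∀ {n} → Subset n
A0 = toSub a0

A0-TDS : ∀ k′ → TDS (A0 {suc k′ * 2 * 2})
A0-TDS k′ = nbrCov⇒TDS a0 (VC⇒nbrCov (suc (k′ * 2)) evenCover evenCover (alt-VC (suc k′) true) (alt-VC (suc k′) true))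

∣A0∣ : ∀ k → ∣ A0 {k * 2 * 2} ∣ ≡ k + k
∣A0∣ k = trans (∣toSub∣ (k * 2 * 2) a0) (trans (count-weave (k * 2) evenCover evenCover) (cong₂ _+_ (count-alt k true) (count-alt k true)))

-- Every total dominating set S of C_{4k} is joined to A0 in D_m when m ≥ |S| + 1 and m ≥ 2k + 2:
-- first each class moves to a minimum cover, then each minimum cover moves to the even one.
toA0 : ∀ {k m} → 0 < k → (S : Subset (k * 2 * 2)) → TDS S → ∣ S ∣ + 1 ≤ m → k + k + 2 ≤ m → DPath m S A0
toA0 {suc k′} {m} _ S tds sizeS bound =
  subst (λ T → DPath m T A0) (trans (toSub-cong {h = weave f g} {h} split) (toSub-at S)) (dcat p₁ (dcat p₂ (dcat p₃ p₄)))
  where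
  k = suc k′
  h = at S
  f = evens h
  g = odds h
  split : Agree (k * 2 * 2) (weave f g) h
  split i _ = weave-split h i
  classes : VC (k * 2) f × VC (k * 2) g
  classes = nbrCov⇒VC (suc (k′ * 2)) h (TDS⇒nbrCov h (subst TDS (sym (toSub-at S)) tds))
  vf = proj₁ classes
  vg = proj₂ classes
  cf = count (k * 2) f
  cg = count (k * 2) g
  ∣S∣ : ∣ S ∣ ≡ cf + cg
  ∣S∣ = trans (cong ∣_∣ (sym (toSub-at S))) (trans (∣toSub∣ (k * 2 * 2) h) (count-split (k * 2) h))
  alt₁ : Σ Bool λ c → Walk (k * 2) (suc cf) f (alt c)
  alt₁ = toAlt {k} {f} (s≤s z≤n) vf
  alt₂ : Σ Bool λ c → Walk (k * 2) (suc cg) g (alt c)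
  alt₂ = toAlt {k} {g} (s≤s z≤n) vg
  c₁ = proj₁ alt₁
  c₂ = proj₁ alt₂
  b₁ : suc cf + cg ≤ m
  b₁ = ≤-trans (≤-reflexive (trans (+-comm 1 (cf + cg)) (cong (_+ 1) (sym ∣S∣)))) sizeS
  b₂ : count (k * 2) (alt c₁) + suc cg ≤ m
  b₂ = ≤-trans (+-monoˡ-≤ (suc cg) (subst (_≤ cf) (sym (count-alt k c₁)) (VC-size {k} {f} vf))) (≤-trans (≤-reflexive (+-suc cf cg)) b₁)
  b₃ : k + 2 + count (k * 2) (alt c₂) ≤ m
  b₃ = subst (_≤ m) (trans (+-comm (k + k) 2) (trans (sym (+-assoc 2 k k)) (cong₂ _+_ (+-comm 2 k) (sym (count-alt k c₂))))) bound
  b₄ : count (k * 2) evenCover + (k + 2) ≤ m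
  b₄ = subst (_≤ m) (trans (+-assoc k k 2) (cong (_+ (k + 2)) (sym (count-alt k true)))) bound
  p₁ : DPath m (toSub (weave f g)) (toSub (weave (alt c₁) g))
  p₁ = liftˡ {g = g} vg b₁ (proj₂ alt₁)
  p₂ : DPath m (toSub (weave (alt c₁) g)) (toSub (weave (alt c₁) (alt c₂)))
  p₂ = liftʳ {f = alt c₁} (alt-VC k c₁) b₂ (proj₂ alt₂)
  p₃ : DPath m (toSub (weave (alt c₁) (alt c₂))) (toSub (weave evenCover (alt c₂)))
  p₃ = liftˡ {g = alt c₂} (alt-VC k c₂) b₃ (toEven {k} (s≤s z≤n) c₁)
  p₄ : DPath m (toSub (weave evenCover (alt c₂))) A0
  p₄ = liftʳ {f = evenCover} (alt-VC k true) b₄ (toEven {k} (s≤s z≤n) c₂)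

connected : ∀ {k n m} → 0 < k → n ≡ k * 2 * 2 → (S T : Subset n) → TDS S → TDS T →
  ∣ S ∣ + 1 ≤ m → ∣ T ∣ + 1 ≤ m → k + k + 2 ≤ m → DPath m S T
connected k>0 refl S T tdsS tdsT sizeS sizeT bound =
  dcat (toA0 k>0 S tdsS sizeS bound) (drev (toA0 k>0 T tdsT sizeT bound))

Rigid : ∀ {n} → Subset n → Set
Rigid {n} A = ∀ T (v : Fin n) → TDS T → (∀ u → u ∈ T → u ∈ A ⊎ u ≡ v) → A ⊆ T

NearA : ∀ {n} → Subset n → Subset n → Set
NearA {n} A S = A ⊆ S × Σ (Fin n) λ v → ∀ u → u ∈ S → u ∈ A ⊎ u ≡ v

near-step : ∀ {n} {A S S′ : Subset n} → Rigid A → NearA A S → InD (∣ A ∣ + 1) S′ → DEdge S S′ → NearA A S′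
near-step {A = A} {S} _ (A⊆S , v , near) (_ , size) (inj₁ (w , w∉S , refl)) =
  (λ x∈A → p⊆p∪q ⁅ w ⁆ (A⊆S x∈A)) , w , near′
  where
  -- S has no vertex outside A, since adding w to such an S would exceed |A| + 1
  S⊆A : ∀ u → u ∈ S → u ∈ A
  S⊆A u u∈S with near u u∈S
  ... | inj₁ u∈A = u∈A
  ... | inj₂ _ with u ∈? A
  ...   | yes u∈A = u∈A
  ...   | no u∉A = contradiction (≤-trans (s≤s (p⊂q⇒∣p∣<∣q∣ A⊂S)) (≤-trans (p⊂q⇒∣p∣<∣q∣ S⊂S′) (≤-trans size (≤-reflexive (+-comm ∣ A ∣ 1))))) (<-irrefl refl)
    where
    A⊂S : A ⊂ S
    A⊂S = A⊆S , u , u∈S , u∉A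
    S⊂S′ : S ⊂ S ∪ ⁅ w ⁆
    S⊂S′ = p⊆p∪q ⁅ w ⁆ , w , x∈p∪q⁺ (inj₂ (x∈⁅x⁆ w)) , w∉S
  near′ : ∀ u → u ∈ S ∪ ⁅ w ⁆ → u ∈ A ⊎ u ≡ w
  near′ u u∈ with x∈p∪q⁻ S ⁅ w ⁆ u∈
  ... | inj₁ u∈S = inj₁ (S⊆A u u∈S)
  ... | inj₂ u∈w = inj₂ (x∈⁅y⁆⇒x≡y w u∈w)
near-step {S = S} {S′} rigid (_ , v , near) (tds′ , _) (inj₂ (w , _ , S≡S′+w)) = rigid S′ v tds′ near′ , v , near′
  where
  near′ : ∀ u → u ∈ S′ → _
  near′ u u∈ = near u (subst (u ∈_) (sym S≡S′+w) (x∈p∪q⁺ (inj₁ u∈)))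

near-path : ∀ {n} {A S T : Subset n} → Rigid A → NearA A S → DPath (∣ A ∣ + 1) S T → NearA A T
near-path _ near (here _) = near
near-path rigid near (step _ e p) = near-path rigid (near-step rigid near (dhead p) e) p

rigid-disconnected : ∀ {n} {A B : Subset (suc n)} → Rigid A → TDS A → TDS B → ∣ B ∣ ≤ ∣ A ∣ + 1 → ¬ (A ⊆ B) →
  Disconnected (suc n) (∣ A ∣ + 1)
rigid-disconnected {A = A} {B} rigid tdsA tdsB sizeB A⊈B =
  A , B , (tdsA , m≤m+n _ 1) , (tdsB , sizeB) ,
  λ path → A⊈B (proj₁ (near-path rigid ((λ x∈A → x∈A) , fzero , (λ u u∈A → inj₁ u∈A)) path))

evenCover-forced : ∀ {k x} → 2 ≤ k → VC (k * 2) x →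
  (∀ i j → i < k → j < k → x (suc (i * 2)) ≡ true → x (suc (j * 2)) ≡ true → i ≡ j) →
  Below (k * 2) evenCover x
evenCover-forced {k} {x} k≥2 vc oneOdd i i< e =
  trans (sym (weave-split x i)) (weave-below {k} {f′ = evens x} {g′ = odds x} allEven (λ _ _ ()) i i< e)
  where
  allEven : Below k (λ _ → true) (evens x)
  allEven i i< _ with evens x i in e
  ... | true = refl
  ... | false = contradiction (oneOdd (cpred k i) i (cpred<n i<) i< oddBefore oddHere) (cpred-irrefl k≥2)
    where
    oddHere : odds x i ≡ true
    oddHere = subst (λ a → a ∨ odds x i ≡ true) e (proj₁ (VC⇒pairCov {k} {x} vc) i i<)
    oddBefore : odds x (cpred k i) ≡ true
    oddBefore with ∨-cases (proj₂ (VC⇒pairCov {k} {x} vc) (cpred k i) (cpred<n i<))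
    ... | inj₁ o = o
    ... | inj₂ ev = contradiction (trans (sym e) (subst (λ j → evens x j ≡ true) (csuc-cpred i<) ev)) λ ()

-- A0 is rigid on C_{4k} for k ≥ 2: a TDS inside A0 plus one vertex v has, in each class, only v
-- at odd class positions, hence all even class positions, i.e. all of A0
A0-rigid : ∀ k → 2 ≤ k → Rigid (A0 {k * 2 * 2})
A0-rigid k@(suc k′) k≥2 T v tds near = subst (A0 ⊆_) (toSub-at T) (toSub-mono {h = a0} {h} a0⊑h)
  where
  n = k * 2 * 2
  h = at T
  classes : VC (k * 2) (evens h) × VC (k * 2) (odds h)
  classes = nbrCov⇒VC (suc (k′ * 2)) h (TDS⇒nbrCov h (subst TDS (sym (toSub-at T)) tds))
  pinned : ∀ p → p < n → h p ≡ true → a0 p ≡ false → p ≡ toℕ v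
  pinned p p< hp ap with near (fromℕ< p<) (subst (fromℕ< p< ∈_) (toSub-at T) (toSub∈ h (subst (λ q → h q ≡ true) (sym (toℕ-fromℕ< p<)) hp)))
  ... | inj₁ u∈A0 = contradiction (trans (sym ap) (subst (λ q → a0 q ≡ true) (toℕ-fromℕ< p<) (∈toSub a0 u∈A0))) λ ()
  ... | inj₂ u≡v = trans (sym (toℕ-fromℕ< p<)) (cong toℕ u≡v)
  a0-odd₀ : ∀ i → a0 (suc (i * 2) * 2) ≡ false
  a0-odd₀ i = trans (weave-even evenCover evenCover (suc (i * 2))) (weave-odd (λ _ → true) (λ _ → false) i)
  a0-odd₁ : ∀ i → a0 (suc (suc (i * 2) * 2)) ≡ false
  a0-odd₁ i = trans (weave-odd evenCover evenCover (suc (i * 2))) (weave-odd (λ _ → true) (λ _ → false) i)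
  oneOdd₀ : ∀ i j → i < k → j < k → evens h (suc (i * 2)) ≡ true → evens h (suc (j * 2)) ≡ true → i ≡ j
  oneOdd₀ i j i< j< hi hj =
    *-cancelʳ-≡ i j 2 (suc-injective (*-cancelʳ-≡ (suc (i * 2)) (suc (j * 2)) 2
      (trans (pinned _ (even< (odd< i<)) hi (a0-odd₀ i)) (sym (pinned _ (even< (odd< j<)) hj (a0-odd₀ j))))))
  oneOdd₁ : ∀ i j → i < k → j < k → odds h (suc (i * 2)) ≡ true → odds h (suc (j * 2)) ≡ true → i ≡ j
  oneOdd₁ i j i< j< hi hj =
    *-cancelʳ-≡ i j 2 (suc-injective (*-cancelʳ-≡ (suc (i * 2)) (suc (j * 2)) 2 (suc-injective
      (trans (pinned _ (odd< (odd< i<)) hi (a0-odd₁ i)) (sym (pinned _ (odd< (odd< j<)) hj (a0-odd₁ j)))))))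
  a0⊑h : Below n a0 h
  a0⊑h i i< e = trans (sym (weave-split h i))
    (weave-below {k * 2} {f′ = evens h} {g′ = odds h}
      (evenCover-forced k≥2 (proj₁ classes) oneOdd₀) (evenCover-forced k≥2 (proj₂ classes) oneOdd₁) i i< e)

-- A TDS in which every vertex has exactly one neighbour inside is minimal: if x is dropped,
-- its partner keeps no neighbour in the smaller set.
AllP2⇒minimal : ∀ {n} (S : Subset n) → AllP2 S → ∀ T → T ⊂ S → ¬ TDS T
AllP2⇒minimal S p2 T (T⊆S , x , x∈S , x∉T) tds with p2 x x∈S
... | inj₁ (nx∈S , _) with p2 (next x) nx∈S
...   | inj₁ (_ , px∉S) = px∉S (subst (_∈ S) (sym (prev-next x)) x∈S)
...   | inj₂ (nnx∉S , _) with TDS⇒nbr tds (next x)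
...     | inj₁ nnx∈T = nnx∉S (T⊆S nnx∈T)
...     | inj₂ x∈T = x∉T (subst (_∈ T) (prev-next x) x∈T)
AllP2⇒minimal S p2 T (T⊆S , x , x∈S , x∉T) tds | inj₂ (_ , px∈S) with p2 (prev x) px∈S
...   | inj₂ (nx∉S , _) = nx∉S (subst (_∈ S) (sym (next-prev x)) x∈S)
...   | inj₁ (_ , ppx∉S) with TDS⇒nbr tds (prev x)
...     | inj₁ x∈T = x∉T (subst (_∈ T) (next-prev x) x∈T)
...     | inj₂ ppx∈T = ppx∉S (T⊆S ppx∈T)

a0-period : ∀ M r → a0 (M * 2 * 2 + r) ≡ a0 r
a0-period zero r = refl
a0-period (suc M) r = a0-period M r

a0-spread : ∀ j → a0 j ∨ a0 (suc (suc j)) ≡ true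
a0-spread 0 = refl
a0-spread 1 = refl
a0-spread 2 = refl
a0-spread 3 = refl
a0-spread (suc (suc (suc (suc j)))) = a0-spread j

a0-P2 : ∀ j → a0 (suc j) ≡ true →
  (a0 (suc (suc j)) ≡ true × a0 j ≡ false) ⊎ (a0 (suc (suc j)) ≡ false × a0 j ≡ true)
a0-P2 0 _ = inj₂ (refl , refl)
a0-P2 3 _ = inj₁ (refl , refl)
a0-P2 (suc (suc (suc (suc j)))) e = a0-P2 j e

a0-P2P1 : ∀ j → a0 j ≡ true → a0 (suc j) ≡ true → a0 (3 + j) ≡ false
a0-P2P1 0 _ _ = refl
a0-P2P1 (suc (suc (suc (suc j)))) e e′ = a0-P2P1 j e e′

-- S* on C_{12 + 4M}: the pairs {0,1}, {3,4}, {6,7}, {9,10} (each followed by a single gap),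
-- then pairs {4i, 4i+1} for 3 ≤ i < M + 3 as in A0
star : ℕ → Bool
star 0 = true
star 1 = true
star 2 = false
star 3 = true
star 4 = true
star 5 = false
star 6 = true
star 7 = true
star 8 = false
star 9 = true
star 10 = true
star 11 = false
star (suc (suc (suc (suc (suc (suc (suc (suc (suc (suc (suc (suc i)))))))))))) = a0 i

mark : ℕ → Bool
mark 0 = true
mark 3 = true
mark 6 = true
mark 9 = true
mark _ = false

star-spread : ∀ i → star i ∨ star (suc (suc i)) ≡ true
star-spread 0 = refl
star-spread 1 = refl
star-spread 2 = refl
star-spread 3 = refl
star-spread 4 = refl
star-spread 5 = refl
star-spread 6 = refl
star-spread 7 = refl
star-spread 8 = refl
star-spread 9 = refl
star-spread 10 = refl
star-spread 11 = refl
star-spread (suc (suc (suc (suc (suc (suc (suc (suc (suc (suc (suc (suc j)))))))))))) = a0-spread j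

star-P2 : ∀ i → star (suc i) ≡ true →
  (star (suc (suc i)) ≡ true × star i ≡ false) ⊎ (star (suc (suc i)) ≡ false × star i ≡ true)
star-P2 0 _ = inj₂ (refl , refl)
star-P2 2 _ = inj₁ (refl , refl)
star-P2 3 _ = inj₂ (refl , refl)
star-P2 5 _ = inj₁ (refl , refl)
star-P2 6 _ = inj₂ (refl , refl)
star-P2 8 _ = inj₁ (refl , refl)
star-P2 9 _ = inj₂ (refl , refl)
star-P2 11 _ = inj₁ (refl , refl)
star-P2 (suc (suc (suc (suc (suc (suc (suc (suc (suc (suc (suc (suc j)))))))))))) e = a0-P2 j e

star-last : ∀ M → star (pred (12 + M * 2 * 2)) ≡ false
star-last zero = refl
star-last (suc M) = trans (cong a0 (+-comm 3 (M * 2 * 2))) (a0-period M 3)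

module Star (M : ℕ) where

  n : ℕ
  n = 12 + M * 2 * 2

  -- the successor of the last vertex is v_0, which lies in S*
  star-csuc : ∀ {i} → i < n → star (suc i) ≡ true → star (csuc n i) ≡ true
  star-csuc i< e with csuc-cases i<
  ... | inj₁ (_ , c) = subst (λ j → star j ≡ true) (sym c) e
  ... | inj₂ (_ , c) = subst (λ j → star j ≡ true) (sym c) refl

  star-inner : ∀ {i} → i < n → star i ≡ true → suc i < n × csuc n i ≡ suc i
  star-inner i< e with csuc-cases i<
  ... | inj₁ r = r
  ... | inj₂ (last , _) = contradiction (trans (sym e) (subst (λ j → star j ≡ false) (cong pred (sym last)) (star-last M))) λ ()

  star-nbrCov : NbrCov n star
  star-nbrCov zero _ = ∨-inr (star (pred n)) (star-csuc (s≤s z≤n) refl)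
  star-nbrCov (suc j) j< with ∨-cases (star-spread j)
  ... | inj₁ e = ∨-inl _ e
  ... | inj₂ e = ∨-inr (star j) (star-csuc j< e)

  star-allP2 : ∀ i → i < n → star i ≡ true →
    (star (csuc n i) ≡ true × star (cpred n i) ≡ false) ⊎ (star (csuc n i) ≡ false × star (cpred n i) ≡ true)
  star-allP2 i i< e rewrite proj₂ (star-inner i< e) with i
  ... | zero = inj₁ (refl , star-last M)
  ... | suc j = star-P2 j e

  Start : ℕ → Set
  Start i = star (cpred n i) ≡ false × star i ≡ true × star (csuc n i) ≡ true ×
            star (csuc n (csuc n i)) ≡ false × star (csuc n (csuc n (csuc n i))) ≡ true

  mark⇒start : ∀ i → mark i ≡ true → Start i
  mark⇒start 0 _ = star-last M , refl , refl , refl , refl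
  mark⇒start 1 ()
  mark⇒start 2 ()
  mark⇒start 3 _ = refl , refl , refl , refl , refl
  mark⇒start 4 ()
  mark⇒start 5 ()
  mark⇒start 6 _ = refl , refl , refl , refl , refl
  mark⇒start 7 ()
  mark⇒start 8 ()
  mark⇒start 9 _ = refl , refl , refl , refl , star-csuc (m≤m+n 12 (M * 2 * 2)) refl
  mark⇒start (suc (suc (suc (suc (suc (suc (suc (suc (suc (suc i)))))))))) ()

  -- past position 11, two consecutive vertices of S* start a block 1100 that does not wrap
  -- around to v_0, since n - 12 is a multiple of 4
  start⇒mark : ∀ i → i < n → Start i → mark i ≡ true
  start⇒mark 0 _ _ = refl
  start⇒mark 1 _ (() , _)
  start⇒mark 2 _ (_ , () , _)
  start⇒mark 3 _ _ = refl
  start⇒mark 4 _ (() , _)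
  start⇒mark 5 _ (_ , () , _)
  start⇒mark 6 _ _ = refl
  start⇒mark 7 _ (() , _)
  start⇒mark 8 _ (_ , () , _)
  start⇒mark 9 _ _ = refl
  start⇒mark 10 _ (() , _)
  start⇒mark 11 _ (_ , () , _)
  start⇒mark (suc (suc (suc (suc (suc (suc (suc (suc (suc (suc (suc (suc j)))))))))))) i< (_ , s₀ , s₁ , _ , s₃) =
    contradiction (a0-P2P1 j s₀ s₁′) third
    where
    step₀ : 13 + j < n × csuc n (12 + j) ≡ 13 + j
    step₀ = star-inner i< s₀
    s₁′ : a0 (suc j) ≡ true
    s₁′ = subst (λ x → star x ≡ true) (proj₂ step₀) s₁
    step₁ : 14 + j < n × csuc n (13 + j) ≡ 14 + j
    step₁ = star-inner (proj₁ step₀) s₁′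
    s₃′ : star (csuc n (14 + j)) ≡ true
    s₃′ = subst (λ x → star (csuc n x) ≡ true) (proj₂ step₁)
            (subst (λ x → star (csuc n (csuc n x)) ≡ true) (proj₂ step₀) s₃)
    third : a0 (3 + j) ≢ false
    third f with csuc-cases (proj₁ step₁)
    ... | inj₁ (_ , c) = contradiction (trans (sym f) (subst (λ x → star x ≡ true) c s₃′)) λ ()
    ... | inj₂ (wrap , _) = contradiction (trans (sym f) a0-wrap) λ ()
      where
      a0-wrap : a0 (3 + j) ≡ true
      a0-wrap = trans (cong a0 (trans (+-cancelˡ-≡ 12 (3 + j) (M * 2 * 2) wrap) (sym (+-identityʳ _)))) (a0-period M 0)

  S* : Subset n
  S* = toSub star

  toℕ-next² : ∀ (v : Fin n) → toℕ (next (next v)) ≡ csuc n (csuc n (toℕ v))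
  toℕ-next² v = trans (toℕ-next (next v)) (cong (csuc n) (toℕ-next v))

  toℕ-next³ : ∀ (v : Fin n) → toℕ (next (next (next v))) ≡ csuc n (csuc n (csuc n (toℕ v)))
  toℕ-next³ v = trans (toℕ-next (next (next v))) (cong (csuc n) (toℕ-next² v))

  S*-allP2 : AllP2 S*
  S*-allP2 v v∈ with star-allP2 (toℕ v) (toℕ<n v) (∈toSub star v∈)
  ... | inj₁ (a , b) = inj₁ (at-∈ star (toℕ-next v) a , at-∉ star (toℕ-prev v) b)
  ... | inj₂ (a , b) = inj₂ (at-∉ star (toℕ-next v) a , at-∈ star (toℕ-prev v) b)

  S*-P2MTDS : P2MTDS S*
  S*-P2MTDS = (tds , AllP2⇒minimal S* S*-allP2) , S*-allP2
    where
    tds : TDS S*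
    tds = nbrCov⇒TDS star star-nbrCov

  ∣S*∣ : ∣ S* ∣ ≡ 8 + (M + M)
  ∣S*∣ = trans (∣toSub∣ n star) (cong (8 +_) (trans (count-weave (M * 2) evenCover evenCover) (cong₂ _+_ (count-alt M true) (count-alt M true))))

  S*-count : HasP2P1Count S* 4
  S*-count = toSub mark , trans (∣toSub∣ n mark) (cong (4 +_) (count-false (M * 2 * 2))) , λ v → mk⇔ (to v) (from v)
    where
    to : ∀ v → v ∈ toSub mark → P2P1Start S* v
    to v v∈ with mark⇒start (toℕ v) (∈toSub mark v∈)
    ... | a , b , c , d , e = at-∉ star (toℕ-prev v) a , at-∈ star refl b , at-∈ star (toℕ-next v) c ,
                              at-∉ star (toℕ-next² v) d , at-∈ star (toℕ-next³ v) e
    from : ∀ v → P2P1Start S* v → v ∈ toSub mark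
    from v (a , b , c , d , e) = toSub∈ mark (start⇒mark (toℕ v) (toℕ<n v)
      (∉-at star (toℕ-prev v) a , ∈toSub star b , ∈-at star (toℕ-next v) c ,
       ∉-at star (toℕ-next² v) d , ∈-at star (toℕ-next³ v) e))

double : ∀ k → 2 * k ≡ k + k
double k = cong (k +_) (+-identityʳ k)

-- (i): A0 is rigid, and A2 = {v_i : i ≡ 2, 3 (mod 4)} is a TDS of the same size avoiding v_0 ∈ A0
disconnected : ∀ {k n} → 2 ≤ k → n ≡ k * 2 * 2 → Disconnected n (2 * k + 1)
disconnected {k@(suc k′)} k≥2 refl =
  subst (Disconnected _) (cong (_+ 1) (trans (∣A0∣ k) (sym (double k))))
    (rigid-disconnected (A0-rigid k k≥2) (A0-TDS k′) tdsA2 sizeA2 A0⊈A2)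
  where
  a2 : ℕ → Bool
  a2 = weave oddCover oddCover
  tdsA2 : TDS (toSub {k * 2 * 2} a2)
  tdsA2 = nbrCov⇒TDS a2 (VC⇒nbrCov (suc (k′ * 2)) oddCover oddCover (alt-VC k false) (alt-VC k false))
  sizeA2 : ∣ toSub {k * 2 * 2} a2 ∣ ≤ ∣ A0 {k * 2 * 2} ∣ + 1
  sizeA2 = ≤-trans (≤-reflexive (trans (∣toSub∣ (k * 2 * 2) a2) (trans (count-weave (k * 2) oddCover oddCover)
             (trans (cong₂ _+_ (count-alt k false) (count-alt k false)) (sym (∣A0∣ k)))))) (m≤m+n _ 1)
  A0⊈A2 : ¬ (A0 ⊆ toSub a2)
  A0⊈A2 A0⊆A2 = contradiction (∈toSub a2 (A0⊆A2 (toSub∈ a0 {fzero} refl))) λ ()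

starSet : ∀ {k n} → n ≡ k * 2 * 2 → 12 ≤ 4 * k →
  Σ (Subset n) λ S → P2MTDS S × ∣ S ∣ ≡ 2 * k + 2 × HasP2P1Count S 4
starSet {0} refl ()
starSet {1} refl (s≤s (s≤s (s≤s (s≤s ()))))
starSet {2} refl (s≤s (s≤s (s≤s (s≤s (s≤s (s≤s (s≤s (s≤s ()))))))))
starSet {suc (suc (suc M))} refl _ = S* , S*-P2MTDS , trans ∣S*∣ (size M) , S*-count
  where
  open Star M
  size : ∀ M → 8 + (M + M) ≡ 2 * (3 + M) + 2
  size = solve-∀

-- (iii), first half: minimum TDSs have 2k vertices
min-connected : ∀ {k n} → 0 < k → n ≡ k * 2 * 2 → ∀ (S T : Subset n) → MinTDS S → MinTDS T → DPath (2 * k + 2) S T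
min-connected {k@(suc k′)} k>0 refl S T (tdsS , minS) (tdsT , minT) =
  connected k>0 refl S T tdsS tdsT (bound {S} minS) (bound {T} minT) (≤-reflexive (cong (_+ 2) (sym (double k))))
  where
  bound : ∀ {U} → (∀ V → TDS V → ∣ U ∣ ≤ ∣ V ∣) → ∣ U ∣ + 1 ≤ 2 * k + 2
  bound {U} min = +-mono-≤ (≤-trans (min A0 (A0-TDS k′)) (≤-reflexive (trans (∣A0∣ k) (sym (double k))))) (s≤s z≤n)

p2-connected : ∀ {k n} → 0 < k → n ≡ k * 2 * 2 → ∀ (S T : Subset n) → P2MTDS S → P2MTDS T →
  (∣ S ∣ ≡ 2 * k ⊎ ∣ S ∣ ≡ 2 * k + 2) → (∣ T ∣ ≡ 2 * k ⊎ ∣ T ∣ ≡ 2 * k + 2) → DPath (2 * k + 3) S T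
p2-connected {k} k>0 eq S T ((tdsS , _) , _) ((tdsT , _) , _) sizeS sizeT =
  connected {k} k>0 eq S T tdsS tdsT (bound {S} sizeS) (bound {T} sizeT) (≤-trans (≤-reflexive (cong (_+ 2) (sym (double k)))) (+-monoʳ-≤ (2 * k) (n≤1+n 2)))
  where
  bound : ∀ {U : Subset _} → ∣ U ∣ ≡ 2 * k ⊎ ∣ U ∣ ≡ 2 * k + 2 → ∣ U ∣ + 1 ≤ 2 * k + 3
  bound (inj₁ e) rewrite e = +-monoʳ-≤ (2 * k) (s≤s z≤n)
  bound (inj₂ e) rewrite e = ≤-reflexive (+-assoc (2 * k) 2 1)

lemma3p7 : (k : ℕ) → 2 ≤ k →
    -- (i)
    Disconnected (4 * k) (2 * k + 1)
    -- (ii)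
    × (12 ≤ 4 * k → Σ (Subset (4 * k)) λ S →
         P2MTDS S × ∣ S ∣ ≡ 2 * k + 2 × HasP2P1Count S 4)
    -- (iii)
    × (∀ (S T : Subset (4 * k)) → MinTDS S → MinTDS T → DPath (2 * k + 2) S T)
    × (∀ (S T : Subset (4 * k)) → P2MTDS S → P2MTDS T →
         (∣ S ∣ ≡ 2 * k ⊎ ∣ S ∣ ≡ 2 * k + 2) →
         (∣ T ∣ ≡ 2 * k ⊎ ∣ T ∣ ≡ 2 * k + 2) →
         DPath (2 * k + 3) S T)
lemma3p7 k k≥2 =
  disconnected k≥2 n≡ , starSet {k} n≡ , min-connected k>0 n≡ , p2-connected k>0 n≡
  where
  n≡ : 4 * k ≡ k * 2 * 2
  n≡ = trans (*-comm 4 k) (sym (*-assoc k 2 2))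
  k>0 : 0 < k
  k>0 = ≤-trans (s≤s z≤n) k≥2
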